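{- Let $n = 2^k p^2$, where $p$ is an odd prime and $k$ is a nonnegative integer, be a $2$-near perfect number whose two omitted divisors are both powers of $2$ (i.e. both of the form $2^a$ with $0 \le a \le k$). Then $n = 18$, and the omitted divisors are $1$ and $2$.
   Context: $\sigma(n)$ denotes the sum of the positive divisors of $n$. A positive integer $n$ is called $2$-near perfect if $\sigma(n) = 2n + d_1 + d_2$ for some two distinct positive divisors $d_1, d_2$ of $n$; these $d_1, d_2$ are called the omitted divisors. -}

module Defs where

open import Data.Nat using (ℕ; suc; _+_; _*_)
open import Data.Nat.Divisibility using (_∣_; _∣?_)
open import Data.List using (List; filter; map; upTo)
open import Data.Nat.ListAction using (sum)
open import Data.Product using (_×_)
open import Relation.Binary.PropositionalEquality using (_≡_; _≢_)

divisors : ℕ → List ℕ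
divisors n = filter (_∣? n) (map suc (upTo n))

σ : ℕ → ℕ
σ n = sum (divisors n)

TwoNearPerfectWith : ℕ → ℕ → ℕ → Set
TwoNearPerfectWith n d₁ d₂ =
  (d₁ ∣ n) × (d₂ ∣ n) × (d₁ ≢ d₂) × (σ n ≡ 2 * n + d₁ + d₂)

{-# OPTIONS --safe #-}
-- With M = 2^(k+1) and S = 1 + p + p², multiplicativity of σ on the odd part gives
-- σ(n) = (M − 1) S, so σ(n) = 2n + A with A = 2^a + 2^b becomes A + S = M (1 + p).
-- As A < M, comparing M with 1 + p forces M = 1 + p and A = p.  Since p is odd,
-- exactly one exponent is 0, say p = 1 + 2^b, and then 2^k = 1 + 2^(b-1) forces
-- k = b = 1, i.e. p = 3 and n = 18.
module Submission where

open import Defs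
open import Data.Nat using (ℕ; zero; suc; _+_; _*_; _^_; _≤_; _<_; NonZero; ≢-nonZero⁻¹; nonTrivial⇒n>1)
open import Data.Nat.Properties
open import Data.Nat.Divisibility
open import Data.Nat.Primality using (Prime; prime[2]; prime⇒irreducible; prime⇒nonZero; prime⇒nonTrivial; euclidsLemma)
open import Data.Nat.GCD using (gcd[m,n]∣m; gcd[m,n]∣n)
open import Data.Nat.Coprimality using (Coprime; gcd≡1⇒coprime; coprime-divisor)
open import Data.Nat.ListAction using (sum)
open import Data.Nat.ListAction.Properties using (sum-++; sum-↭)
open import Data.Nat.Tactic.RingSolver using (solve-∀)
open import Data.List using (List; []; _∷_; _++_; map; upTo)
open import Data.List.Membership.Propositional using (_∈_)
open import Data.List.Membership.Propositional.Properties
  using (∈-filter⁺; ∈-filter⁻; ∈-map⁺; ∈-map⁻; ∈-upTo⁺; ∈-++⁺ˡ; ∈-++⁺ʳ; ∈-++⁻)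
open import Data.List.Membership.Propositional.Properties.WithK using (unique∧set⇒bag)
open import Data.List.Relation.Binary.BagAndSetEquality using (∼bag⇒↭)
open import Data.List.Relation.Unary.Any using (here; there)
open import Data.List.Relation.Unary.All using ([]; _∷_)
open import Data.List.Relation.Unary.AllPairs using ([]; _∷_)
open import Data.List.Relation.Unary.Unique.Propositional using (Unique)
import Data.List.Relation.Unary.Unique.Propositional.Properties as Unique
open import Data.Product using (_×_; _,_; proj₂)
open import Data.Sum using (_⊎_; inj₁; inj₂)
open import Function.Bundles using (mk⇔)
open import Relation.Nullary using (¬_; yes; no; contradiction)
open import Relation.Binary.Definitions using (tri<; tri≈; tri>)
open import Relation.Binary.PropositionalEquality
  using (_≡_; _≢_; refl; sym; trans; cong; subst; subst₂; module ≡-Reasoning)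

¬2∣1 : ¬ 2 ∣ 1
¬2∣1 2∣1 with () ← ∣1⇒≡1 2∣1

2∣2^[1+n] : ∀ n → 2 ∣ 2 ^ suc n
2∣2^[1+n] n = m∣m*n (2 ^ n)

odd⇒nonZero : ∀ {m} → ¬ 2 ∣ m → NonZero m
odd⇒nonZero {zero} m-odd = contradiction (2 ∣0) m-odd
odd⇒nonZero {suc m} _ = _

2∣n⇒¬2∣1+n : ∀ {n} → 2 ∣ n → ¬ 2 ∣ 1 + n
2∣n⇒¬2∣1+n {n} 2∣n 2∣1+n = ¬2∣1 (∣m+n∣m⇒∣n (subst (2 ∣_) (+-comm 1 n) 2∣1+n) 2∣n)

odd-prime⇒odd : ∀ {p} → Prime p → p ≢ 2 → ¬ 2 ∣ p
odd-prime⇒odd p-prime p≢2 2∣p with prime⇒irreducible p-prime 2∣p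
... | inj₁ ()
... | inj₂ 2≡p = p≢2 (sym 2≡p)

odd⇒odd-square : ∀ {p} → ¬ 2 ∣ p → ¬ 2 ∣ p * p
odd⇒odd-square {p} p-odd 2∣p*p with euclidsLemma p p prime[2] 2∣p*p
... | inj₁ 2∣p = p-odd 2∣p
... | inj₂ 2∣p = p-odd 2∣p

prime∤⇒coprime : ∀ {p d} → Prime p → ¬ p ∣ d → Coprime d p
prime∤⇒coprime {p} {d} p-prime p∤d with prime⇒irreducible p-prime (gcd[m,n]∣n d p)
... | inj₁ gcd≡1 = gcd≡1⇒coprime gcd≡1
... | inj₂ gcd≡p = contradiction (subst (_∣ d) gcd≡p (gcd[m,n]∣m d p)) p∤d

odd∣2^k*m⇒∣m : ∀ {d m} → ¬ 2 ∣ d → ∀ k → d ∣ 2 ^ k * m → d ∣ m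
odd∣2^k*m⇒∣m {d} {m} _ zero d∣m = subst (d ∣_) (*-identityˡ m) d∣m
odd∣2^k*m⇒∣m {d} {m} d-odd (suc k) d∣n = odd∣2^k*m⇒∣m d-odd k
  (coprime-divisor (prime∤⇒coprime prime[2] d-odd) (subst (d ∣_) (*-assoc 2 (2 ^ k) m) d∣n))

divisors-unique : ∀ n → Unique (divisors n)
divisors-unique n = Unique.filter⁺ (_∣? n) (Unique.map⁺ suc-injective (Unique.upTo⁺ n))

∈-divisors⁻ : ∀ {n d} → d ∈ divisors n → d ∣ n
∈-divisors⁻ {n} d∈ = proj₂ (∈-filter⁻ (_∣? n) {xs = map suc (upTo n)} d∈)

∈-divisors⁺ : ∀ {n d} → .{{NonZero n}} → d ∣ n → d ∈ divisors n
∈-divisors⁺ {n} {zero} 0∣n = contradiction (0∣⇒≡0 0∣n) (≢-nonZero⁻¹ n)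
∈-divisors⁺ {n} {suc d} d∣n = ∈-filter⁺ (_∣? n) (∈-map⁺ suc (∈-upTo⁺ (∣⇒≤ d∣n))) d∣n

σ≡sum : ∀ {n} .{{_ : NonZero n}} {ds : List ℕ} → Unique ds →
  (∀ {d} → d ∈ ds → d ∣ n) → (∀ {d} → d ∣ n → d ∈ ds) → σ n ≡ sum ds
σ≡sum {n} ds-unique sound complete = sum-↭ (∼bag⇒↭ (unique∧set⇒bag (divisors-unique n) ds-unique
  (mk⇔ (λ d∈ → complete (∈-divisors⁻ d∈)) (λ d∈ → ∈-divisors⁺ (sound d∈)))))

-- For odd m, doublings (divisors m) k lists the divisors of 2^k m, each exactly once.
doublings : List ℕ → ℕ → List ℕ
doublings ds zero = ds
doublings ds (suc k) = ds ++ map (2 *_) (doublings ds k)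

module _ {m : ℕ} {ds : List ℕ} where

  ∈-doublings⁻ : (∀ {d} → d ∈ ds → d ∣ m) → ∀ k {d} → d ∈ doublings ds k → d ∣ 2 ^ k * m
  ∈-doublings⁻ sound zero d∈ = ∣-trans (sound d∈) (n∣m*n 1)
  ∈-doublings⁻ sound (suc k) d∈ with ∈-++⁻ ds d∈
  ... | inj₁ d∈ds = ∣-trans (sound d∈ds) (n∣m*n (2 ^ suc k))
  ... | inj₂ d∈2ds with ∈-map⁻ (2 *_) d∈2ds
  ...   | e , e∈ , refl =
    subst (2 * e ∣_) (sym (*-assoc 2 (2 ^ k) m)) (*-monoʳ-∣ 2 (∈-doublings⁻ sound k e∈))

  ∈-doublings⁺ : (∀ {d} → d ∣ m → d ∈ ds) → ∀ k {d} → d ∣ 2 ^ k * m → d ∈ doublings ds k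
  ∈-doublings⁺ complete zero {d} d∣m = complete (subst (d ∣_) (*-identityˡ m) d∣m)
  ∈-doublings⁺ complete (suc k) {d} d∣n with 2 ∣? d
  ... | no d-odd = ∈-++⁺ˡ (complete (odd∣2^k*m⇒∣m d-odd (suc k) d∣n))
  ... | yes (divides e refl) = ∈-++⁺ʳ ds (subst (_∈ map (2 *_) (doublings ds k)) (*-comm 2 e)
    (∈-map⁺ (2 *_) {x = e} (∈-doublings⁺ complete k
      (*-cancelˡ-∣ 2 (subst₂ _∣_ (*-comm e 2) (*-assoc 2 (2 ^ k) m) d∣n)))))

doublings-unique : ∀ {ds} → (∀ {d} → d ∈ ds → ¬ 2 ∣ d) → Unique ds → ∀ k → Unique (doublings ds k)
doublings-unique _ ds-unique zero = ds-unique
doublings-unique {ds} odd ds-unique (suc k) =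
  Unique.++⁺ ds-unique (Unique.map⁺ (*-cancelˡ-≡ _ _ 2) (doublings-unique odd ds-unique k)) disjoint
  where
  disjoint : ∀ {d} → ¬ (d ∈ ds × d ∈ map (2 *_) (doublings ds k))
  disjoint (d∈ds , d∈2ds) with ∈-map⁻ (2 *_) d∈2ds
  ... | e , _ , refl = odd d∈ds (m∣m*n e)

sum-map-2* : ∀ xs → sum (map (2 *_) xs) ≡ 2 * sum xs
sum-map-2* [] = refl
sum-map-2* (x ∷ xs) = trans (cong (2 * x +_) (sum-map-2* xs)) (sym (*-distribˡ-+ 2 x (sum xs)))

sum-doublings : ∀ ds k → sum (doublings ds k) + sum ds ≡ 2 ^ suc k * sum ds
sum-doublings ds zero = cong (sum ds +_) (sym (+-identityʳ (sum ds)))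
sum-doublings ds (suc k) = begin
  sum (ds ++ map (2 *_) (doublings ds k)) + s  ≡⟨ cong (_+ s) (sum-++ ds _) ⟩
  s + sum (map (2 *_) (doublings ds k)) + s    ≡⟨ cong (λ t → s + t + s) (sum-map-2* (doublings ds k)) ⟩
  s + 2 * sum (doublings ds k) + s             ≡⟨ regroup s (sum (doublings ds k)) ⟩
  2 * (sum (doublings ds k) + s)               ≡⟨ cong (2 *_) (sum-doublings ds k) ⟩
  2 * (2 ^ suc k * s)                          ≡⟨ *-assoc 2 (2 ^ suc k) s ⟨
  2 ^ suc (suc k) * s                          ∎
  where
  open ≡-Reasoning
  s = sum ds
  regroup : ∀ s t → s + 2 * t + s ≡ 2 * (t + s)
  regroup = solve-∀

σ[2^k*m]+σ[m]≡2^[1+k]*σ[m] : ∀ k {m} → ¬ 2 ∣ m → σ (2 ^ k * m) + σ m ≡ 2 ^ suc k * σ m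
σ[2^k*m]+σ[m]≡2^[1+k]*σ[m] k {m} m-odd = begin
  σ (2 ^ k * m) + σ m                ≡⟨ cong (_+ σ m) σ[2^k*m]≡ ⟩
  sum (doublings ds k) + σ m         ≡⟨ sum-doublings ds k ⟩
  2 ^ suc k * σ m                    ∎
  where
  open ≡-Reasoning
  instance
    m≢0 : NonZero m
    m≢0 = odd⇒nonZero m-odd
    2^k≢0 : NonZero (2 ^ k)
    2^k≢0 = m^n≢0 2 k
    n≢0 : NonZero (2 ^ k * m)
    n≢0 = m*n≢0 (2 ^ k) m
  ds = divisors m
  divisors-odd : ∀ {d} → d ∈ ds → ¬ 2 ∣ d
  divisors-odd d∈ 2∣d = m-odd (∣-trans 2∣d (∈-divisors⁻ d∈))
  σ[2^k*m]≡ : σ (2 ^ k * m) ≡ sum (doublings ds k)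
  σ[2^k*m]≡ = σ≡sum (doublings-unique divisors-odd (divisors-unique m) k)
    (∈-doublings⁻ ∈-divisors⁻ k) (∈-doublings⁺ ∈-divisors⁺ k)

module _ {p : ℕ} (p-prime : Prime p) where

  private instance
    p≢0 : NonZero p
    p≢0 = prime⇒nonZero p-prime

  1<p : 1 < p
  1<p = nonTrivial⇒n>1 p {{prime⇒nonTrivial p-prime}}

  ∣p*p⇒∈ : ∀ {d} → d ∣ p * p → d ∈ 1 ∷ p ∷ p * p ∷ []
  ∣p*p⇒∈ {d} d∣p*p with p ∣? d
  ... | yes (divides e refl) with prime⇒irreducible p-prime {e} (*-cancelʳ-∣ p d∣p*p)
  ...   | inj₁ refl = there (here (+-identityʳ p))
  ...   | inj₂ refl = there (there (here refl))
  ∣p*p⇒∈ {d} d∣p*p | no p∤d with prime⇒irreducible p-prime {d} (coprime-divisor (prime∤⇒coprime p-prime p∤d) d∣p*p)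
  ...   | inj₁ refl = here refl
  ...   | inj₂ refl = there (here refl)

  ∈⇒∣p*p : ∀ {d} → d ∈ 1 ∷ p ∷ p * p ∷ [] → d ∣ p * p
  ∈⇒∣p*p (here refl) = 1∣ _
  ∈⇒∣p*p (there (here refl)) = m∣m*n p
  ∈⇒∣p*p (there (there (here refl))) = ∣-refl

  1,p,p*p-unique : Unique (1 ∷ p ∷ p * p ∷ [])
  1,p,p*p-unique = (1≢p ∷ 1≢p*p ∷ []) ∷ (p≢p*p ∷ []) ∷ [] ∷ []
    where
    1≢p : 1 ≢ p
    1≢p 1≡p = <-irrefl 1≡p 1<p
    1≢p*p : 1 ≢ p * p
    1≢p*p 1≡p*p = <-irrefl 1≡p*p (<-≤-trans 1<p (m≤m*n p p))
    p≢p*p : p ≢ p * p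
    p≢p*p p≡p*p = 1≢p (*-cancelˡ-≡ 1 p p (trans (*-identityʳ p) p≡p*p))

  σ[p*p] : σ (p * p) ≡ 1 + p + p * p
  σ[p*p] = trans (σ≡sum {{m*n≢0 p p}} 1,p,p*p-unique ∈⇒∣p*p ∣p*p⇒∈)
                 (cong (λ t → suc (p + t)) (+-identityʳ (p * p)))

2^a+2^b<2^[1+k] : ∀ {a b k} → a < b → b ≤ k → 2 ^ a + 2 ^ b < 2 ^ suc k
2^a+2^b<2^[1+k] {a} {b} {k} a<b b≤k = begin-strict
  2 ^ a + 2 ^ b  <⟨ +-monoˡ-< (2 ^ b) (^-monoʳ-< 2 (n<1+n 1) a<b) ⟩
  2 ^ b + 2 ^ b  ≤⟨ +-mono-≤ (^-monoʳ-≤ 2 b≤k) (^-monoʳ-≤ 2 b≤k) ⟩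
  2 ^ k + 2 ^ k  ≡⟨ cong (2 ^ k +_) (+-identityʳ (2 ^ k)) ⟨
  2 ^ suc k      ∎
  where open ≤-Reasoning

distinct-2^a+2^b<2^[1+k] : ∀ {a b k} → a ≤ k → b ≤ k → a ≢ b → 2 ^ a + 2 ^ b < 2 ^ suc k
distinct-2^a+2^b<2^[1+k] {a} {b} {k} a≤k b≤k a≢b with <-cmp a b
... | tri< a<b _ _ = 2^a+2^b<2^[1+k] a<b b≤k
... | tri≈ _ a≡b _ = contradiction a≡b a≢b
... | tri> _ _ b<a = subst (_< 2 ^ suc k) (+-comm (2 ^ b) (2 ^ a)) (2^a+2^b<2^[1+k] b<a a≤k)

A+[1+p+p*p]≡M*[1+p]⇒M≡1+p∧A≡p : ∀ {A M p} → 1 ≤ p → A < M →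
  A + (1 + p + p * p) ≡ M * (1 + p) → M ≡ 1 + p × A ≡ p
A+[1+p+p*p]≡M*[1+p]⇒M≡1+p∧A≡p {A} {M} {p} 1≤p A<M balance with <-cmp M (1 + p)
... | tri≈ _ refl _ = refl , +-cancelʳ-≡ _ A p (trans balance (square p))
  where
  square : ∀ p → (1 + p) * (1 + p) ≡ p + (1 + p + p * p)
  square = solve-∀
... | tri< M<1+p _ _ = contradiction (sym balance) (<⇒≢ (begin-strict
  M * (1 + p)          ≤⟨ *-monoˡ-≤ (1 + p) (≤-pred M<1+p) ⟩
  p * (1 + p)          ≡⟨ *-distribˡ-+ p 1 p ⟩
  p * 1 + p * p        ≡⟨ cong (_+ p * p) (*-identityʳ p) ⟩
  p + p * p            <⟨ n<1+n (p + p * p) ⟩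
  1 + p + p * p        ≤⟨ m≤n+m (1 + p + p * p) A ⟩
  A + (1 + p + p * p)  ∎))
  where open ≤-Reasoning
... | tri> _ _ 1+p<M = contradiction balance (<⇒≢ (begin-strict
  A + (1 + p + p * p)  <⟨ +-monoˡ-< (1 + p + p * p) A<M ⟩
  M + (1 + p + p * p)  ≤⟨ +-monoʳ-≤ M (+-monoˡ-≤ (p + p * p) 1≤p) ⟩
  M + (2 + p) * p      ≤⟨ +-monoʳ-≤ M (*-monoˡ-≤ p 1+p<M) ⟩
  M + M * p            ≡⟨ cong (_+ M * p) (*-identityʳ M) ⟨
  M * 1 + M * p        ≡⟨ *-distribˡ-+ M 1 p ⟨
  M * (1 + p)          ∎))
  where open ≤-Reasoning

2^k≡1+2^c⇒k≡1∧c≡0 : ∀ k c → 2 ^ k ≡ 1 + 2 ^ c → k ≡ 1 × c ≡ 0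
2^k≡1+2^c⇒k≡1∧c≡0 zero c 1≡1+2^c = contradiction (sym (suc-injective 1≡1+2^c)) (≢-nonZero⁻¹ _ {{m^n≢0 2 c}})
2^k≡1+2^c⇒k≡1∧c≡0 (suc k) (suc c) 2^k≡ = contradiction (subst (2 ∣_) 2^k≡ (2∣2^[1+n] k)) (2∣n⇒¬2∣1+n (2∣2^[1+n] c))
2^k≡1+2^c⇒k≡1∧c≡0 (suc k) zero 2^k≡2 with m^n≡1⇒n≡0∨m≡1 2 k (*-cancelˡ-≡ (2 ^ k) 1 2 2^k≡2)
... | inj₁ refl = refl , refl
... | inj₂ ()

2^[1+k]≡2+2^[1+c]⇒k≡1∧c≡0 : ∀ k c → 2 ^ suc k ≡ 1 + (1 + 2 ^ suc c) → k ≡ 1 × c ≡ 0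
2^[1+k]≡2+2^[1+c]⇒k≡1∧c≡0 k c 2^[1+k]≡ =
  2^k≡1+2^c⇒k≡1∧c≡0 k c (*-cancelˡ-≡ (2 ^ k) (1 + 2 ^ c) 2 (trans 2^[1+k]≡ (sym (*-distribˡ-+ 2 1 (2 ^ c)))))

2^[1+k]≡1+2^a+2^b⇒n≡18 : ∀ {k p} a b → 2 ^ a ≢ 2 ^ b → 2 ^ suc k ≡ 1 + p × 2 ^ a + 2 ^ b ≡ p →
  (2 ^ k * (p * p) ≡ 18) × ((2 ^ a ≡ 1 × 2 ^ b ≡ 2) ⊎ (2 ^ a ≡ 2 × 2 ^ b ≡ 1))
2^[1+k]≡1+2^a+2^b⇒n≡18 zero zero 1≢1 _ = contradiction refl 1≢1
2^[1+k]≡1+2^a+2^b⇒n≡18 {k} zero (suc c) _ (2^[1+k]≡ , refl)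
  with refl , refl ← 2^[1+k]≡2+2^[1+c]⇒k≡1∧c≡0 k c 2^[1+k]≡ = refl , inj₁ (refl , refl)
2^[1+k]≡1+2^a+2^b⇒n≡18 {k} (suc c) zero _ (2^[1+k]≡ , refl)
  with refl , refl ← 2^[1+k]≡2+2^[1+c]⇒k≡1∧c≡0 k c (trans 2^[1+k]≡ (cong suc (+-comm (2 ^ suc c) 1)))
  = refl , inj₂ (refl , refl)
2^[1+k]≡1+2^a+2^b⇒n≡18 {k} (suc a) (suc b) _ (2^[1+k]≡ , refl) =
  contradiction (subst (2 ∣_) 2^[1+k]≡ (2∣2^[1+n] k)) (2∣n⇒¬2∣1+n (∣m∣n⇒∣m+n (2∣2^[1+n] a) (2∣2^[1+n] b)))

σ[2^k*p*p]≡2n+A⇒A+1+p+p*p≡2^[1+k]*[1+p] : ∀ k {p A} → Prime p → p ≢ 2 →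
  σ (2 ^ k * (p * p)) ≡ 2 * (2 ^ k * (p * p)) + A → A + (1 + p + p * p) ≡ 2 ^ suc k * (1 + p)
σ[2^k*p*p]≡2n+A⇒A+1+p+p*p≡2^[1+k]*[1+p] k {p} {A} p-prime p≢2 σ[n]≡ =
  +-cancelˡ-≡ (M * (p * p)) _ _ (begin
    M * (p * p) + (A + S)        ≡⟨ +-assoc (M * (p * p)) A S ⟨
    M * (p * p) + A + S          ≡⟨ cong (λ t → t + A + S) (*-assoc 2 (2 ^ k) (p * p)) ⟩
    2 * n + A + S                ≡⟨ cong (_+ S) σ[n]≡ ⟨
    σ n + S                      ≡⟨ cong (σ n +_) (σ[p*p] p-prime) ⟨
    σ n + σ (p * p)              ≡⟨ σ[2^k*m]+σ[m]≡2^[1+k]*σ[m] k (odd⇒odd-square (odd-prime⇒odd p-prime p≢2)) ⟩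
    M * σ (p * p)                ≡⟨ cong (M *_) (σ[p*p] p-prime) ⟩
    M * ((1 + p) + p * p)        ≡⟨ *-distribˡ-+ M (1 + p) (p * p) ⟩
    M * (1 + p) + M * (p * p)    ≡⟨ +-comm (M * (1 + p)) (M * (p * p)) ⟩
    M * (p * p) + M * (1 + p)    ∎)
  where
  open ≡-Reasoning
  M = 2 ^ suc k
  n = 2 ^ k * (p * p)
  S = 1 + p + p * p

proposition8 : (k p a b : ℕ) → Prime p → p ≢ 2 → a ≤ k → b ≤ k →
    TwoNearPerfectWith (2 ^ k * (p * p)) (2 ^ a) (2 ^ b) →
    (2 ^ k * (p * p) ≡ 18) × ((2 ^ a ≡ 1 × 2 ^ b ≡ 2) ⊎ (2 ^ a ≡ 2 × 2 ^ b ≡ 1))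
proposition8 k p a b p-prime p≢2 a≤k b≤k (_ , _ , 2^a≢2^b , σ[n]≡)
  = 2^[1+k]≡1+2^a+2^b⇒n≡18 {k} a b 2^a≢2^b
      (A+[1+p+p*p]≡M*[1+p]⇒M≡1+p∧A≡p (<⇒≤ (1<p p-prime)) A<M balance)
  where
  balance : 2 ^ a + 2 ^ b + (1 + p + p * p) ≡ 2 ^ suc k * (1 + p)
  balance = σ[2^k*p*p]≡2n+A⇒A+1+p+p*p≡2^[1+k]*[1+p] k p-prime p≢2
    (trans σ[n]≡ (+-assoc (2 * (2 ^ k * (p * p))) (2 ^ a) (2 ^ b)))
  A<M : 2 ^ a + 2 ^ b < 2 ^ suc k
  A<M = distinct-2^a+2^b<2^[1+k] a≤k b≤k (λ a≡b → 2^a≢2^b (cong (2 ^_) a≡b))
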